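{- Let $\Delta$ be a finite thin chamber complex equipped with a map $(F,C)\mapsto FC$ from faces times chambers to chambers satisfying the projection axioms (P1)–(P3). For chambers $C,D$ let $R_C(D)$ be the face of $D$ spanned by the vertices $v$ of $D$ with $(D\setminus v)C\ne D$, and let $\le_C$ be the transitive closure of the relation "$E\le_C D$ if $R_C(E)\le D$". Let $C\mapsto\overline{C}$ be a map from the set of chambers to itself. Then the following are equivalent: (P4) for every codimension-one face $G$ of $\Delta$ and every chamber $C$, $GC\neq G\overline{C}$; (R4) for all chambers $C,D$, $R_C(D)$ and $R_{\overline{C}}(D)$ are complementary faces of $D$ (their vertex sets partition the vertex set of $D$; in the labelled case, the type of $R_C(D)$ is $I$ minus the type of $R_{\overline{C}}(D)$); (S4) for every chamber $C$, the partial orders $\le_C$ and $\le_{\overline{C}}$ are dual (reverse) to each other.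
   Context: A chamber complex is a finite pure simplicial complex (chambers = maximal faces) in which any two chambers are joined by a gallery (sequence of chambers, consecutive ones sharing a codimension-one face). Thin: every codimension-one face lies in exactly two chambers. $F\le G$ is the face relation, $G\lessdot D$ means $G$ is a codimension-one face of $D$, $D\setminus v$ is the codimension-one face of $D$ not containing $v$. Axioms: (P1)(i) $FC=D\Rightarrow F\le D$; (ii) $F\le C\Rightarrow FC=C$; (iii) $FC=D$, $F\le G\le D\Rightarrow GC=D$; (P2) if $F\le D$ and $GC=D$ for all $G$ with $F\le G\lessdot D$ then $FC=D$; (P3) if $FC=D$ and $C_1,\dots,C_n=D$ is a weak $C$-gallery (faces $F_i$ with $F_iC=C_i$ and $F_i\le C_i,C_{i+1}$) then $FC_1=D$. -}

module Defs where

open import Data.Nat using (ℕ; suc)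
open import Data.Bool using (Bool; true; false; _∧_; not)
import Data.Bool as Bool
open import Data.Fin using (Fin)
open import Data.Fin.Subset using (Subset; _∈_; _⊆_; _∪_; _∩_; ⊥; ∣_∣; outside)
open import Data.Vec using (tabulate; lookup; _[_]≔_)
open import Data.Vec.Properties using (≡-dec)
open import Data.Product using (Σ; ∃; _×_)
open import Data.Sum using (_⊎_)
open import Relation.Nullary using (¬_)
open import Relation.Nullary.Decidable using (⌊_⌋)
open import Relation.Binary.PropositionalEquality using (_≡_; _≢_)
open import Relation.Binary.Construct.Closure.ReflexiveTransitive using (Star)
open import Relation.Binary.Construct.Closure.Transitive using (TransClosure)

-- The complex is determined by its set of chambers (maximal faces); a face
-- is any subset of a chamber (the empty face included).

_≟ˢ_ : ∀ {n} (A B : Subset n) → Relation.Nullary.Dec (A ≡ B)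
_≟ˢ_ = ≡-dec Bool._≟_

_∖ᵛ_ : ∀ {n} → Subset n → Fin n → Subset n
D ∖ᵛ v = D [ v ]≔ outside

_⋖_ : ∀ {n} → Subset n → Subset n → Set
G ⋖ D = G ⊆ D × suc ∣ G ∣ ≡ ∣ D ∣

module _ {n : ℕ} (IsChamber : Subset n → Set) where

  IsFace : Subset n → Set
  IsFace F = ∃ λ C → IsChamber C × F ⊆ C

  IsPanel : Subset n → Set
  IsPanel G = ∃ λ D → IsChamber D × G ⋖ D

  Adjacent : Subset n → Subset n → Set
  Adjacent C D = IsChamber C × IsChamber D × ∃ λ G → G ⋖ C × G ⋖ D

record ThinChamberComplex (n : ℕ) : Set₁ where
  field
    IsChamber : Subset n → Set
    rank      : ℕ
    -- pure: all chambers have the same number of vertices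
    -- (so no chamber properly contains another: chambers are the maximal faces)
    pure      : ∀ C → IsChamber C → ∣ C ∣ ≡ rank
    connected : ∀ C D → IsChamber C → IsChamber D → Star (Adjacent IsChamber) C D
    thin      : ∀ G → IsPanel IsChamber G →
                Σ (Subset n) λ C₁ → Σ (Subset n) λ C₂ →
                  C₁ ≢ C₂ × IsChamber C₁ × IsChamber C₂ × G ⊆ C₁ × G ⊆ C₂ ×
                  (∀ C → IsChamber C → G ⊆ C → C ≡ C₁ ⊎ C ≡ C₂)

module _ {n : ℕ} (IsChamber : Subset n → Set) (proj : Subset n → Subset n → Subset n) where

  -- weak C-gallery  C₁, …, Cₘ = D :  WeakGallery C C₁ D
  data WeakGallery (C : Subset n) : Subset n → Subset n → Set where
    end  : ∀ {D} → IsChamber D → WeakGallery C D D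
    step : ∀ {C₁ C₂ D} (F₁ : Subset n) → IsChamber C₁ → IsFace IsChamber F₁ →
           proj F₁ C ≡ C₁ → F₁ ⊆ C₁ → F₁ ⊆ C₂ →
           WeakGallery C C₂ D → WeakGallery C C₁ D

record ProjectionComplex (n : ℕ) : Set₁ where
  field
    Δ    : ThinChamberComplex n
  open ThinChamberComplex Δ public
  field
    proj      : Subset n → Subset n → Subset n
    proj-cham : ∀ F C → IsFace IsChamber F → IsChamber C → IsChamber (proj F C)
    P1i   : ∀ F C → IsFace IsChamber F → IsChamber C → F ⊆ proj F C
    P1ii  : ∀ F C → IsFace IsChamber F → IsChamber C → F ⊆ C → proj F C ≡ C
    P1iii : ∀ F G C → IsFace IsChamber F → IsChamber C →
            F ⊆ G → G ⊆ proj F C → proj G C ≡ proj F C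
    P2    : ∀ F C D → IsChamber C → IsChamber D → F ⊆ D →
            (∀ G → F ⊆ G → G ⋖ D → proj G C ≡ D) → proj F C ≡ D
    P3    : ∀ F C C₁ D → IsFace IsChamber F → IsChamber C → proj F C ≡ D →
            WeakGallery IsChamber proj C C₁ D → proj F C₁ ≡ D

module _ {n : ℕ} (P : ProjectionComplex n) where
  open ProjectionComplex P

  R : Subset n → Subset n → Subset n
  R C D = tabulate λ v → lookup D v ∧ not ⌊ proj (D ∖ᵛ v) C ≟ˢ D ⌋

  _≤⁰[_]_ : Subset n → Subset n → Subset n → Set
  E ≤⁰[ C ] D = IsChamber E × IsChamber D × R C E ⊆ D

  _≤[_]_ : Subset n → Subset n → Subset n → Set
  E ≤[ C ] D = TransClosure (λ X Y → X ≤⁰[ C ] Y) E D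

  P4 : (Subset n → Subset n) → Set
  P4 bar = ∀ G C → IsPanel IsChamber G → IsChamber C → proj G C ≢ proj G (bar C)

  R4 : (Subset n → Subset n) → Set
  R4 bar = ∀ C D → IsChamber C → IsChamber D →
           (R C D ∪ R (bar C) D ≡ D) × (R C D ∩ R (bar C) D ≡ ⊥)

  S4 : (Subset n → Subset n) → Set
  S4 bar = ∀ C → IsChamber C → ∀ D E →
           (D ≤[ C ] E → E ≤[ bar C ] D) × (E ≤[ bar C ] D → D ≤[ C ] E)

{-# OPTIONS --safe #-}
module Submission where

-- R_C(D) is the smallest face F of D with FC = D (P1(iii) and P2), and by P3 every closed weak
-- C-gallery is constant; in particular ≤_C is antisymmetric.
-- P4 ⇒ R4: a vertex v of D in neither R_C(D) nor R_C̄(D) gives (D∖v)C = D = (D∖v)C̄, and one in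
-- both makes (D∖v)C and (D∖v)C̄ the chamber across D∖v from D, which thinness makes unique.
-- P4 ⇒ S4: if R_C(D) ⊆ E, repeatedly replace X := E by (X∖v)C for some v ∈ R_C(X) ∖ R_C(D).
-- This keeps R_C(D) ⊆ X, never revisits a chamber (P3), and stops only when R_C(X) ⊆ R_C(D),
-- i.e. at X = D; since v ∉ R_C̄(X), each move is a step X ≤_C̄ (X∖v)C, so E ≤_C̄ D.
-- R4, S4 ⇒ P4: if GC = GC̄ = X for a panel G, then R_C(X) and R_C̄(X) lie in G, so they do not
-- cover X, and the other chamber Y on G has X ≤_C Y and X ≤_C̄ Y, contradicting antisymmetry.

open import Defs
open import Data.Nat using (ℕ; zero; suc; _<_; s≤s)
open import Data.Nat.Properties using (<-≤-trans; n<1+n; suc-injective; <⇒≢; <⇒≱; ≤-reflexive)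
open import Data.Bool using (true; false; _∧_; not)
open import Data.Fin using (zero; suc)
open import Data.Fin.Properties using (any?)
open import Data.Fin.Subset using (Subset; inside; outside; _∈_; _∉_; _⊆_; _∪_; _∩_; ⊥; ∣_∣)
open import Data.Fin.Subset.Properties
  using ( _∈?_; ∉⊥; ⊆-antisym; p⊆q⇒∣p∣≤∣q∣; p⊂q⇒∣p∣<∣q∣
        ; x∈p∪q⁺; x∈p∪q⁻; x∈p∩q⁺; x∈p∩q⁻; ∩-comm; Empty-unique)
open import Data.Vec using ([]; _∷_; here; there; lookup)
open import Data.Vec.Properties
  using ([]=-injective; []≔-updates; []≔-minimal; []=⇒lookup; lookup⇒[]=; lookup∘tabulate)
open import Data.List using (List; []; _∷_; _++_; map; filter; length)
open import Data.List.Properties using (filter-notAll)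
open import Data.List.Membership.Propositional using () renaming (_∈_ to _∈ˡ_)
open import Data.List.Membership.Propositional.Properties using (∈-++⁺ˡ; ∈-++⁺ʳ; ∈-map⁺; ∈-filter⁺)
open import Data.List.Relation.Unary.Any using (here) renaming (map to any-map)
open import Data.Product using (∃; _×_; _,_; proj₁; proj₂)
open import Data.Sum using (_⊎_; inj₁; inj₂; [_,_]′)
open import Function using (flip; _∘_)
open import Function.Bundles using (_⇔_; mk⇔)
open import Induction.WellFounded using (WellFounded; Acc; acc)
open import Relation.Binary using (Rel; DecidableEquality)
open import Relation.Binary.PropositionalEquality using (_≡_; _≢_; refl; sym; trans; cong; subst)
open import Relation.Binary.Construct.Closure.ReflexiveTransitive using (Star; ε; _◅_)
import Relation.Binary.Construct.Closure.ReflexiveTransitive as Star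
open import Relation.Binary.Construct.Closure.Transitive using ([_]; _∷_) renaming (_++_ to _++⁺_)
open import Relation.Nullary using (¬_; yes; no; ¬?; contradiction)
open import Relation.Nullary.Decidable using (⌊_⌋; _×-dec_; decidable-stable)

allSubsets : ∀ n → List (Subset n)
allSubsets zero    = [] ∷ []
allSubsets (suc n) = map (inside ∷_) (allSubsets n) ++ map (outside ∷_) (allSubsets n)

∈-allSubsets : ∀ {n} (p : Subset n) → p ∈ˡ allSubsets n
∈-allSubsets []            = here refl
∈-allSubsets (inside  ∷ p) = ∈-++⁺ˡ (∈-map⁺ (inside ∷_) (∈-allSubsets p))
∈-allSubsets (outside ∷ p) = ∈-++⁺ʳ _ (∈-map⁺ (outside ∷_) (∈-allSubsets p))

module _ {a ℓ} {A : Set a} (_≟_ : DecidableEquality A) {xs : List A} (complete : ∀ x → x ∈ˡ xs)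
         {_≺_ : Rel A ℓ} (acyclic : ∀ {x y} → x ≺ y → ¬ Star _≺_ y x) where

  private
    _≺⁺_ : Rel A _
    x ≺⁺ z = ∃ λ y → x ≺ y × Star _≺_ y z

    -- ys contains everything reachable from x; after a step x ≺ y we may drop y from ys,
    -- because y is not reachable from itself.
    accessible : ∀ k (ys : List A) {x} → length ys < k → (∀ {z} → x ≺⁺ z → z ∈ˡ ys) →
                 Acc (flip _≺_) x
    accessible (suc k) ys {x} (s≤s |ys|≤k) reach = acc λ {y} x≺y →
      accessible k (filter (λ z → ¬? (z ≟ y)) ys)
        (<-≤-trans (filter-notAll _ ys (any-map (λ y≡z z≢y → z≢y (sym y≡z)) (reach (y , x≺y , ε))))
                   |ys|≤k)
        (λ { {z} y≺⁺z@(w , y≺w , w≺*z) →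
               ∈-filter⁺ _ (reach (y , x≺y , y≺w ◅ w≺*z)) (λ { refl → acyclic y≺w w≺*z }) })

  acyclic⇒noetherian : WellFounded (flip _≺_)
  acyclic⇒noetherian x = accessible (suc (length xs)) xs (n<1+n _) (λ _ → complete _)

1+∣p∖ᵛx∣≡∣p∣ : ∀ {n} {p : Subset n} {x} → x ∈ p → suc ∣ p ∖ᵛ x ∣ ≡ ∣ p ∣
1+∣p∖ᵛx∣≡∣p∣                   here        = refl
1+∣p∖ᵛx∣≡∣p∣ {p = inside  ∷ p} (there x∈p) = cong suc (1+∣p∖ᵛx∣≡∣p∣ x∈p)
1+∣p∖ᵛx∣≡∣p∣ {p = outside ∷ p} (there x∈p) = 1+∣p∖ᵛx∣≡∣p∣ x∈p

p∖ᵛx⊆p : ∀ {n} (p : Subset n) x → p ∖ᵛ x ⊆ p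
p∖ᵛx⊆p (_ ∷ p) zero    (there y∈p∖ᵛx) = there y∈p∖ᵛx
p∖ᵛx⊆p (_ ∷ p) (suc x) here           = here
p∖ᵛx⊆p (_ ∷ p) (suc x) (there y∈p∖ᵛx) = there (p∖ᵛx⊆p p x y∈p∖ᵛx)

module _ {n : ℕ} where

  ⊆⊎⊈ : ∀ (p q : Subset n) → p ⊆ q ⊎ ∃ λ x → x ∈ p × x ∉ q
  ⊆⊎⊈ p q with any? (λ x → x ∈? p ×-dec ¬? (x ∈? q))
  ... | yes witness = inj₂ witness
  ... | no none     = inj₁ λ {x} x∈p → decidable-stable (x ∈? q) (λ x∉q → none (x , x∈p , x∉q))

  p⊆q∧∣p∣≡∣q∣⇒p≡q : ∀ {p q : Subset n} → p ⊆ q → ∣ p ∣ ≡ ∣ q ∣ → p ≡ q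
  p⊆q∧∣p∣≡∣q∣⇒p≡q {p} {q} p⊆q ∣p∣≡∣q∣ with ⊆⊎⊈ q p
  ... | inj₁ q⊆p           = ⊆-antisym p⊆q q⊆p
  ... | inj₂ (x , x∈q , x∉p) = contradiction ∣p∣≡∣q∣ (<⇒≢ (p⊂q⇒∣p∣<∣q∣ (p⊆q , x , x∈q , x∉p)))

  x∉p∖ᵛx : ∀ (p : Subset n) x → x ∉ p ∖ᵛ x
  x∉p∖ᵛx p x x∈p∖ᵛx with () ← []=-injective x∈p∖ᵛx ([]≔-updates p x)

  q⊆p∖ᵛx : ∀ {p q : Subset n} {x} → q ⊆ p → x ∉ q → q ⊆ p ∖ᵛ x
  q⊆p∖ᵛx {p} {x = x} q⊆p x∉q {y} y∈q = []≔-minimal p y x (λ { refl → x∉q y∈q }) (q⊆p y∈q)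

  ⋖⇒≡∖ᵛ : ∀ {G D : Subset n} → G ⋖ D → ∃ λ v → v ∈ D × G ≡ D ∖ᵛ v
  ⋖⇒≡∖ᵛ {G} {D} (G⊆D , 1+∣G∣≡∣D∣) with ⊆⊎⊈ D G
  ... | inj₁ D⊆G = contradiction (p⊆q⇒∣p∣≤∣q∣ D⊆G) (<⇒≱ (≤-reflexive 1+∣G∣≡∣D∣))
  ... | inj₂ (v , v∈D , v∉G) =
    v , v∈D , p⊆q∧∣p∣≡∣q∣⇒p≡q (q⊆p∖ᵛx G⊆D v∉G)
                                (suc-injective (trans 1+∣G∣≡∣D∣ (sym (1+∣p∖ᵛx∣≡∣p∣ v∈D))))

module _ {n : ℕ} (Δ : ThinChamberComplex n) where
  open ThinChamberComplex Δ

  chamber∖ᵛ-panel : ∀ {X v} → IsChamber X → v ∈ X → IsPanel IsChamber (X ∖ᵛ v)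
  chamber∖ᵛ-panel {X} {v} chX v∈X = X , chX , p∖ᵛx⊆p X v , 1+∣p∖ᵛx∣≡∣p∣ v∈X

  chamber⊈panel : ∀ {G X} → IsPanel IsChamber G → IsChamber X → ¬ X ⊆ G
  chamber⊈panel (D , chD , _ , 1+∣G∣≡∣D∣) chX X⊆G =
    <⇒≱ (≤-reflexive (trans 1+∣G∣≡∣D∣ (trans (pure _ chD) (sym (pure _ chX))))) (p⊆q⇒∣p∣≤∣q∣ X⊆G)

  other-chamber : ∀ {G X} → IsPanel IsChamber G → IsChamber X → G ⊆ X →
                  ∃ λ Y → IsChamber Y × G ⊆ Y × Y ≢ X
  other-chamber {G} {X} pG chX G⊆X with thin G pG
  ... | C₁ , C₂ , C₁≢C₂ , chC₁ , chC₂ , G⊆C₁ , G⊆C₂ , only with only X chX G⊆X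
  ...   | inj₁ refl = C₂ , chC₂ , G⊆C₂ , C₁≢C₂ ∘ sym
  ...   | inj₂ refl = C₁ , chC₁ , G⊆C₁ , C₁≢C₂

  other-chamber-unique : ∀ {G X Y Y′} → IsPanel IsChamber G →
                         IsChamber X → IsChamber Y → IsChamber Y′ → G ⊆ X → G ⊆ Y → G ⊆ Y′ →
                         Y ≢ X → Y′ ≢ X → Y ≡ Y′
  other-chamber-unique {G} {X} {Y} {Y′} pG chX chY chY′ G⊆X G⊆Y G⊆Y′ Y≢X Y′≢X with thin G pG
  ... | _ , _ , _ , _ , _ , _ , _ , only
      with only X chX G⊆X | only Y chY G⊆Y | only Y′ chY′ G⊆Y′
  ... | inj₁ refl | inj₁ refl | _         = contradiction refl Y≢X
  ... | inj₁ refl | inj₂ refl | inj₁ refl = contradiction refl Y′≢X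
  ... | inj₁ refl | inj₂ refl | inj₂ refl = refl
  ... | inj₂ refl | inj₂ refl | _         = contradiction refl Y≢X
  ... | inj₂ refl | inj₁ refl | inj₂ refl = contradiction refl Y′≢X
  ... | inj₂ refl | inj₁ refl | inj₁ refl = refl

module _ {n : ℕ} (P : ProjectionComplex n) where
  open ProjectionComplex P

  chamber-face : ∀ {D F} → IsChamber D → F ⊆ D → IsFace IsChamber F
  chamber-face chD F⊆D = _ , chD , F⊆D

  proj-chamber : ∀ {C D F} → IsChamber C → IsChamber D → F ⊆ D → IsChamber (proj F C)
  proj-chamber chC chD F⊆D = proj-cham _ _ (chamber-face chD F⊆D) chC

  ⊆proj : ∀ {C D F} → IsChamber C → IsChamber D → F ⊆ D → F ⊆ proj F C
  ⊆proj chC chD F⊆D = P1i _ _ (chamber-face chD F⊆D) chC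

  ∈R⁻ : ∀ {C D v} → v ∈ R P C D → v ∈ D × proj (D ∖ᵛ v) C ≢ D
  ∈R⁻ {C} {D} {v} v∈R
    with lookup D v in D[v] | proj (D ∖ᵛ v) C ≟ˢ D | trans (sym (lookup∘tabulate _ v)) ([]=⇒lookup v∈R)
  ... | true  | no moved | _  = lookup⇒[]= v D D[v] , moved
  ... | true  | yes _    | ()
  ... | false | _        | ()

  ∈R⁺ : ∀ {C D v} → v ∈ D → proj (D ∖ᵛ v) C ≢ D → v ∈ R P C D
  ∈R⁺ {C} {D} {v} v∈D moved = lookup⇒[]= v (R P C D) (trans (lookup∘tabulate _ v) R-bit)
    where
      R-bit : lookup D v ∧ not ⌊ proj (D ∖ᵛ v) C ≟ˢ D ⌋ ≡ true
      R-bit rewrite []=⇒lookup v∈D with proj (D ∖ᵛ v) C ≟ˢ D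
      ... | yes fixed = contradiction fixed moved
      ... | no _      = refl

  R⊆ : ∀ {C D} → R P C D ⊆ D
  R⊆ = proj₁ ∘ ∈R⁻

  ∉R⇒proj≡ : ∀ {C D v} → v ∈ D → v ∉ R P C D → proj (D ∖ᵛ v) C ≡ D
  ∉R⇒proj≡ {C} {D} {v} v∈D v∉R = decidable-stable (proj (D ∖ᵛ v) C ≟ˢ D) (v∉R ∘ ∈R⁺ v∈D)

  proj≡⇒R⊆ : ∀ {C D F} → IsChamber C → IsChamber D → F ⊆ D → proj F C ≡ D → R P C D ⊆ F
  proj≡⇒R⊆ {C} {D} {F} chC chD F⊆D FC≡D {v} v∈R with v ∈? F
  ... | yes v∈F = v∈F
  ... | no v∉F  = contradiction (trans (P1iii F (D ∖ᵛ v) C (chamber-face chD F⊆D) chC F⊆D∖v D∖v⊆FC) FC≡D)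
                                (proj₂ (∈R⁻ v∈R))
    where
      F⊆D∖v : F ⊆ D ∖ᵛ v
      F⊆D∖v = q⊆p∖ᵛx F⊆D v∉F
      D∖v⊆FC : D ∖ᵛ v ⊆ proj F C
      D∖v⊆FC = subst (D ∖ᵛ v ⊆_) (sym FC≡D) (p∖ᵛx⊆p D v)

  proj-R : ∀ {C D} → IsChamber C → IsChamber D → proj (R P C D) C ≡ D
  proj-R {C} {D} chC chD = P2 (R P C D) C D chC chD R⊆ panel-fixed
    where
      panel-fixed : ∀ G → R P C D ⊆ G → G ⋖ D → proj G C ≡ D
      panel-fixed G R⊆G G⋖D with ⋖⇒≡∖ᵛ G⋖D
      ... | v , v∈D , refl = ∉R⇒proj≡ v∈D (x∉p∖ᵛx D v ∘ R⊆G)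

  R⊆⇒proj≡ : ∀ {C D F} → IsChamber C → IsChamber D → R P C D ⊆ F → F ⊆ D → proj F C ≡ D
  R⊆⇒proj≡ {C} {D} {F} chC chD R⊆F F⊆D =
    trans (P1iii (R P C D) F C (chamber-face chD R⊆) chC R⊆F (subst (F ⊆_) (sym RC≡D) F⊆D)) RC≡D
    where
      RC≡D : proj (R P C D) C ≡ D
      RC≡D = proj-R chC chD

  data WeakStep (C X Y : Subset n) : Set where
    weakStep : ∀ F → IsChamber X → IsChamber Y → F ⊆ X → F ⊆ Y → proj F C ≡ X → WeakStep C X Y

  weakGallery : ∀ {C X Y} → IsChamber Y → Star (WeakStep C) X Y → WeakGallery IsChamber proj C X Y
  weakGallery chY ε = end chY
  weakGallery chY (weakStep F chX _ F⊆X F⊆X′ FC≡X ◅ steps) =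
    step F chX (chamber-face chX F⊆X) FC≡X F⊆X F⊆X′ (weakGallery chY steps)

  weakStep-cycle⇒≡ : ∀ {C X Y} → IsChamber C → WeakStep C X Y → Star (WeakStep C) Y X → X ≡ Y
  weakStep-cycle⇒≡ {C} {X} {Y} chC (weakStep F chX chY F⊆X F⊆Y FC≡X) back =
    trans (sym (P3 F C Y X F-face chC FC≡X (weakGallery chX back))) (P1ii F Y F-face chY F⊆Y)
    where
      F-face : IsFace IsChamber F
      F-face = chamber-face chX F⊆X

  ≤⁰⇒weakStep : ∀ {C X Y} → IsChamber C → _≤⁰[_]_ P X C Y → WeakStep C X Y
  ≤⁰⇒weakStep chC (chX , chY , R⊆Y) = weakStep _ chX chY R⊆ R⊆Y (proj-R chC chX)

  ≤⇒weakSteps : ∀ {C X Y} → IsChamber C → _≤[_]_ P X C Y → Star (WeakStep C) X Y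
  ≤⇒weakSteps chC [ X≤⁰Y ]       = ≤⁰⇒weakStep chC X≤⁰Y ◅ ε
  ≤⇒weakSteps chC (X≤⁰Y ∷ Y≤Z) = ≤⁰⇒weakStep chC X≤⁰Y ◅ ≤⇒weakSteps chC Y≤Z

  ≤⁰-antisym : ∀ {C X Y} → IsChamber C → _≤⁰[_]_ P X C Y → _≤[_]_ P Y C X → X ≡ Y
  ≤⁰-antisym chC X≤⁰Y Y≤X = weakStep-cycle⇒≡ chC (≤⁰⇒weakStep chC X≤⁰Y) (≤⇒weakSteps chC Y≤X)

  data _⟶[_]_ : Subset n → Subset n → Subset n → Set where
    move : ∀ {X C v} → IsChamber X → v ∈ R P C X → X ⟶[ C ] proj (X ∖ᵛ v) C

  move-chamber : ∀ {C X Y} → IsChamber C → X ⟶[ C ] Y → IsChamber Y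
  move-chamber chC (move {X} {v = v} chX _) = proj-chamber chC chX (p∖ᵛx⊆p X v)

  move⇒weakStep : ∀ {C X Y} → IsChamber C → X ⟶[ C ] Y → WeakStep C Y X
  move⇒weakStep chC X⟶Y@(move {X} {v = v} chX _) =
    weakStep (X ∖ᵛ v) (move-chamber chC X⟶Y) chX (⊆proj chC chX (p∖ᵛx⊆p X v)) (p∖ᵛx⊆p X v) refl

  ⟶-acyclic : ∀ {C X Y} → IsChamber C → X ⟶[ C ] Y → ¬ Star _⟶[ C ]_ Y X
  ⟶-acyclic chC X⟶Y@(move _ v∈R) Y⟶*X =
    proj₂ (∈R⁻ v∈R)
      (weakStep-cycle⇒≡ chC (move⇒weakStep chC X⟶Y) (Star.reverse (move⇒weakStep chC) Y⟶*X))

  ⟶-noetherian : ∀ {C} → IsChamber C → WellFounded (flip _⟶[ C ]_)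
  ⟶-noetherian chC = acyclic⇒noetherian _≟ˢ_ ∈-allSubsets (⟶-acyclic chC)

  R⊆⇒⟶* : ∀ {C E X} → IsChamber C → IsChamber E → IsChamber X → R P C E ⊆ X → Star _⟶[ C ]_ X E
  R⊆⇒⟶* {C} {E} chC chE chX = go (⟶-noetherian chC _) chX
    where
      go : ∀ {X} → Acc (flip _⟶[ C ]_) X → IsChamber X → R P C E ⊆ X → Star _⟶[ C ]_ X E
      go {X} (acc further) chX RE⊆X with ⊆⊎⊈ (R P C X) (R P C E)
      ... | inj₁ RX⊆RE = subst (Star _ X) X≡E ε
        where
          X≡E : X ≡ E
          X≡E = trans (sym (R⊆⇒proj≡ chC chX RX⊆RE RE⊆X)) (proj-R chC chE)
      ... | inj₂ (v , v∈RX , v∉RE) = X⟶X′ ◅ go (further X⟶X′) (move-chamber chC X⟶X′) RE⊆X′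
        where
          X⟶X′ = move chX v∈RX
          RE⊆X′ : R P C E ⊆ proj (X ∖ᵛ v) C
          RE⊆X′ = ⊆proj chC chX (p∖ᵛx⊆p X v) ∘ q⊆p∖ᵛx RE⊆X v∉RE

  R∩R⇒proj≡ : ∀ {C C′ X v} → IsChamber C → IsChamber C′ → IsChamber X →
              v ∈ R P C X → v ∈ R P C′ X → proj (X ∖ᵛ v) C ≡ proj (X ∖ᵛ v) C′
  R∩R⇒proj≡ {C} {C′} {X} {v} chC chC′ chX v∈R v∈R′ =
    other-chamber-unique Δ (chamber∖ᵛ-panel Δ chX (R⊆ v∈R))
      chX (proj-chamber chC chX G⊆X) (proj-chamber chC′ chX G⊆X)
      G⊆X (⊆proj chC chX G⊆X) (⊆proj chC′ chX G⊆X) (proj₂ (∈R⁻ v∈R)) (proj₂ (∈R⁻ v∈R′))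
    where
      G⊆X : X ∖ᵛ v ⊆ X
      G⊆X = p∖ᵛx⊆p X v

  module _ {C C′} (chC : IsChamber C) (disjoint : ∀ {X} → IsChamber X → R P C X ∩ R P C′ X ≡ ⊥) where

    move⇒≤⁰ : ∀ {X Y} → X ⟶[ C ] Y → _≤⁰[_]_ P X C′ Y
    move⇒≤⁰ X⟶Y@(move {X} {v = v} chX v∈R) =
      chX , move-chamber chC X⟶Y , ⊆proj chC chX (p∖ᵛx⊆p X v) ∘ q⊆p∖ᵛx R⊆ v∉R′
      where
        v∉R′ : v ∉ R P C′ X
        v∉R′ v∈R′ = ∉⊥ (subst (v ∈_) (disjoint chX) (x∈p∩q⁺ (v∈R , v∈R′)))

    ≤⁰*⇒≤ : ∀ {X Y} → IsChamber X → Star (λ A B → _≤⁰[_]_ P A C′ B) X Y → _≤[_]_ P X C′ Y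
    ≤⁰*⇒≤ chX ε                             = [ chX , chX , R⊆ ]
    ≤⁰*⇒≤ _   (X≤⁰Y@(_ , chY , _) ◅ Y≤⁰*Z) = X≤⁰Y ∷ ≤⁰*⇒≤ chY Y≤⁰*Z

    ≤⁰-reverse : ∀ {D E} → _≤⁰[_]_ P D C E → _≤[_]_ P E C′ D
    ≤⁰-reverse (chD , chE , RD⊆E) = ≤⁰*⇒≤ chE (Star.map move⇒≤⁰ (R⊆⇒⟶* chC chD chE RD⊆E))

    ≤-reverse : ∀ {D E} → _≤[_]_ P D C E → _≤[_]_ P E C′ D
    ≤-reverse [ D≤⁰E ]       = ≤⁰-reverse D≤⁰E
    ≤-reverse (D≤⁰X ∷ X≤E) = ≤-reverse X≤E ++⁺ ≤⁰-reverse D≤⁰X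

module Opposition {n : ℕ} (P : ProjectionComplex n) (bar : Subset n → Subset n)
  (bar-chamber : ∀ C → ProjectionComplex.IsChamber P C → ProjectionComplex.IsChamber P (bar C)) where
  open ProjectionComplex P

  P4⇒R-disjoint : P4 P bar → ∀ {C X} → IsChamber C → IsChamber X → R P C X ∩ R P (bar C) X ≡ ⊥
  P4⇒R-disjoint p4 {C} {X} chC chX = Empty-unique λ (v , v∈∩) →
    let v∈R , v∈R̄ = x∈p∩q⁻ _ _ v∈∩ in
    p4 (X ∖ᵛ v) C (chamber∖ᵛ-panel Δ chX (R⊆ P v∈R)) chC
       (R∩R⇒proj≡ P chC (bar-chamber C chC) chX v∈R v∈R̄)

  P4⇒R-cover : P4 P bar → ∀ {C X} → IsChamber C → IsChamber X → R P C X ∪ R P (bar C) X ≡ X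
  P4⇒R-cover p4 {C} {X} chC chX = ⊆-antisym ([ R⊆ P , R⊆ P ]′ ∘ x∈p∪q⁻ _ _) X⊆R∪R̄
    where
      X⊆R∪R̄ : X ⊆ R P C X ∪ R P (bar C) X
      X⊆R∪R̄ {v} v∈X with v ∈? R P C X | v ∈? R P (bar C) X
      ... | yes v∈R | _        = x∈p∪q⁺ (inj₁ v∈R)
      ... | no _    | yes v∈R̄ = x∈p∪q⁺ (inj₂ v∈R̄)
      ... | no v∉R  | no v∉R̄  = contradiction (trans (∉R⇒proj≡ P v∈X v∉R) (sym (∉R⇒proj≡ P v∈X v∉R̄)))
                                              (p4 (X ∖ᵛ v) C (chamber∖ᵛ-panel Δ chX v∈X) chC)

  P4⇒R4 : P4 P bar → R4 P bar
  P4⇒R4 p4 C D chC chD = P4⇒R-cover p4 chC chD , P4⇒R-disjoint p4 chC chD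

  R4⇒P4 : R4 P bar → P4 P bar
  R4⇒P4 r4 G C G-panel@(D , chD , G⊆D , _) chC GC≡GC̄ = chamber⊈panel Δ G-panel chX X⊆G
    where
      X = proj G C
      chX = proj-chamber P chC chD G⊆D
      G⊆X = ⊆proj P chC chD G⊆D
      X⊆G : X ⊆ G
      X⊆G = subst (_⊆ G) (proj₁ (r4 C X chC chX))
              ([ proj≡⇒R⊆ P chC chX G⊆X refl
               , proj≡⇒R⊆ P (bar-chamber C chC) chX G⊆X (sym GC≡GC̄) ]′ ∘ x∈p∪q⁻ _ _)

  R4⇒S4 : R4 P bar → S4 P bar
  R4⇒S4 r4 C chC D E =
    ≤-reverse P chC disjoint , ≤-reverse P (bar-chamber C chC) (λ chX → trans (∩-comm _ _) (disjoint chX))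
    where
      disjoint : ∀ {X} → IsChamber X → R P C X ∩ R P (bar C) X ≡ ⊥
      disjoint chX = proj₂ (r4 C _ chC chX)

  S4⇒P4 : S4 P bar → P4 P bar
  S4⇒P4 s4 G C G-panel@(D , chD , G⊆D , _) chC GC≡GC̄ =
    let Y , chY , G⊆Y , Y≢X = other-chamber Δ G-panel chX G⊆X in
    Y≢X (sym (≤⁰-antisym P chC̄ (X≤⁰ chC̄ (sym GC≡GC̄) chY G⊆Y)
                                (proj₁ (s4 C chC X Y) [ X≤⁰ chC refl chY G⊆Y ])))
    where
      X = proj G C
      chX = proj-chamber P chC chD G⊆D
      G⊆X = ⊆proj P chC chD G⊆D
      chC̄ = bar-chamber C chC
      X≤⁰ : ∀ {C′ Y} → IsChamber C′ → proj G C′ ≡ X → IsChamber Y → G ⊆ Y → _≤⁰[_]_ P X C′ Y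
      X≤⁰ chC′ GC′≡X chY G⊆Y = chX , chY , G⊆Y ∘ proj≡⇒R⊆ P chC′ chX G⊆X GC′≡X

theorem9p4 : ∀ {n} (P : ProjectionComplex n) (bar : Subset n → Subset n) →
    (∀ C → ProjectionComplex.IsChamber P C → ProjectionComplex.IsChamber P (bar C)) →
    (P4 P bar ⇔ R4 P bar) × (P4 P bar ⇔ S4 P bar)
theorem9p4 P bar bar-chamber = mk⇔ P4⇒R4 R4⇒P4 , mk⇔ (R4⇒S4 ∘ P4⇒R4) S4⇒P4
  where open Opposition P bar bar-chamber
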